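{- There is a constant $c>0.1$ such that for arbitrarily large $n$ there is a finite set $A$ of real numbers with distinct consecutive differences and $|A|\geq n$ such that $|A+A|=O\left(|A|^{2-c}\right)$ (with an implied constant independent of $n$).
   Context: A finite set $A=\{a_1<a_2<\dots<a_k\}$ of reals has distinct consecutive differences if $a_{i+1}-a_i=a_{j+1}-a_j$ implies $i=j$. $A+A=\{a+a': a,a'\in A\}$. -}

module Defs where

open import Data.Nat using (ℕ)
open import Data.Integer using (ℤ; _+_; _-_; _<_; _≟_)
open import Data.List using (List; []; _∷_; length; deduplicate; concatMap; map)
open import Data.List.Relation.Unary.Linked using (Linked)
open import Data.List.Relation.Unary.Unique.Propositional using (Unique)
open import Data.Product using (_×_)

-- A finite set A = {a₁ < a₂ < … < a_k} is represented by the list [a₁, …, a_k]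
-- which is required to be strictly increasing.
StrictlyIncreasing : List ℤ → Set
StrictlyIncreasing = Linked _<_

consecDiffs : List ℤ → List ℤ
consecDiffs []            = []
consecDiffs (a ∷ [])      = []
consecDiffs (a ∷ b ∷ xs)  = (b - a) ∷ consecDiffs (b ∷ xs)

DistinctConsecDiffs : List ℤ → Set
DistinctConsecDiffs A = Unique (consecDiffs A)

allSums : List ℤ → List ℤ
allSums A = concatMap (λ a → map (λ a' → a + a') A) A

sumsetSize : List ℤ → ℕ
sumsetSize A = length (deduplicate _≟_ (allSums A))

-- B = {0, 1, 4, 10, 12, 17} is a Sidon set: its 30 nonzero differences are distinct, and |B + B| = 21.
-- An Eulerian circuit of the complete digraph on B is a closed walk in B whose steps are distinct.
-- Such walks are iterated in base 35: if y is a closed walk of length L with distinct nonzero steps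
-- and gcd (31, L) = 1, the walk whose low digit runs around the circuit while its high digit runs
-- around y has distinct steps by the Chinese remainder theorem, and a prefix of 30 low-digit steps
-- makes its length 30 + 31 L, again coprime to 31.  After m rounds this gives a closed walk w of
-- length N - 1, N = 31^(m+1), with distinct steps and values whose m + 1 digits lie in B.  Then
-- A = {w t + t 35^(m+1) : t < N} has distinct consecutive differences, and A + A is contained in
-- {σ + s 35^(m+1) : s < 2N, all digits of σ in B + B}, so |A + A| ≤ 2 N 21^(m+1).  As
-- 21^9 · 31 ≤ 31^9, this gives |A + A|^9 · N ≤ 2^9 N^18, i.e. the exponent 2 - 1/9.

module Submission where

open import Defs
open import Data.Nat using (ℕ; _≤_; _<_; _*_; _^_)
open import Data.Integer using (ℤ)
open import Data.List using (List; length)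
open import Data.Product using (Σ; _×_)

open import Data.Nat using (zero; suc; _+_; _∸_; _%_; NonZero; z≤n; s≤s; z<s; s<s; _≟_; _≤?_; _<?_)
open import Data.Nat.Properties
open import Data.Nat.DivMod
open import Data.Nat.Divisibility
open import Data.Nat.Coprimality using (Coprime; coprime-divisor)
open import Data.Nat.Tactic.RingSolver using (solve-∀)
import Data.Integer as ℤ
import Data.Integer.Properties as ℤ
import Data.Integer.Tactic.RingSolver as ℤ-Solver
open import Data.List using ([]; _∷_; _++_; map; cartesianProductWith; applyUpTo; upTo)
open import Data.List.Properties using (length-++; length-++-sucʳ; length-map; length-applyUpTo; length-upTo)
open import Data.List.Membership.Propositional using (_∈_; find)
open import Data.List.Membership.Propositional.Properties
  using (∈-∃++; ∈-++⁻; ∈-++⁺ˡ; ∈-++⁺ʳ; ∈-cartesianProductWith⁺; ∈-cartesianProductWith⁻;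
         ∈-map⁺; ∈-map⁻; ∈-concatMap⁻; ∈-applyUpTo⁻; ∈-upTo⁺; ∈-deduplicate⁻)
open import Data.List.Membership.DecPropositional _≟_ using (_∈?_)
open import Data.List.Relation.Unary.All as All using ()
open import Data.List.Relation.Unary.Any using (here; there)
open import Data.List.Relation.Unary.Unique.Propositional using (Unique; _∷_)
import Data.List.Relation.Unary.Unique.Propositional.Properties as Unique
open import Data.List.Relation.Unary.Unique.DecPropositional.Properties using (deduplicate-!)
import Data.List.Relation.Unary.Linked.Properties as Linked
open import Data.Vec using (Vec; lookup; _∷_; [])
open import Data.Vec.Membership.Propositional.Properties using (∈-lookup)
import Data.Vec.Relation.Unary.All as VecAll
open import Data.Product using (_,_; proj₁; proj₂)
open import Data.Sum using (inj₁; inj₂; [_,_]′)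
open import Function using (id)
open import Relation.Binary.PropositionalEquality
open import Relation.Nullary using (¬_; contradiction)
open import Relation.Nullary.Decidable using (from-yes; _→-dec_)

digits-injective : ∀ {K a a′ b b′} → a < K → a′ < K →
                   a + b * K ≡ a′ + b′ * K → a ≡ a′ × b ≡ b′
digits-injective {K@(suc _)} {a} {a′} {b} {b′} a<K a′<K eq = a≡a′ , b≡b′
  where
  open ≡-Reasoning
  a≡a′ : a ≡ a′
  a≡a′ = begin
    a                ≡⟨ m<n⇒m%n≡m a<K ⟨
    a % K            ≡⟨ [m+kn]%n≡m%n a b K ⟨
    (a + b * K) % K  ≡⟨ cong (_% K) eq ⟩
    (a′ + b′ * K) % K ≡⟨ [m+kn]%n≡m%n a′ b′ K ⟩
    a′ % K           ≡⟨ m<n⇒m%n≡m a′<K ⟩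
    a′               ∎
  b≡b′ : b ≡ b′
  b≡b′ = *-cancelʳ-≡ b b′ K (+-cancelˡ-≡ a _ _ (trans eq (cong (_+ b′ * K) (sym a≡a′))))

m%n≡o%n⇒n∣o∸m : ∀ m n o .{{_ : NonZero n}} → m % n ≡ o % n → n ∣ o ∸ m
m%n≡o%n⇒n∣o∸m m n o eq = divides (o / n ∸ m / n) (begin
    o ∸ m                                     ≡⟨ cong₂ _∸_ (m≡m%n+[m/n]*n o n) (m≡m%n+[m/n]*n m n) ⟩
    (o % n + o / n * n) ∸ (m % n + m / n * n) ≡⟨ cong (λ r → (o % n + o / n * n) ∸ (r + m / n * n)) eq ⟩
    (o % n + o / n * n) ∸ (o % n + m / n * n) ≡⟨ [m+n]∸[m+o]≡n∸o (o % n) _ _ ⟩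
    o / n * n ∸ m / n * n                     ≡⟨ *-distribʳ-∸ n (o / n) (m / n) ⟨
    (o / n ∸ m / n) * n                       ∎)
  where open ≡-Reasoning

coprime⇒*-∣ : ∀ {m n o} → Coprime m n → m ∣ o → n ∣ o → m * n ∣ o
coprime⇒*-∣ {m} {n} c m∣o (divides q refl) =
  *-monoˡ-∣ n (coprime-divisor c (subst (m ∣_) (*-comm q n) m∣o))

∣∧<⇒≡0 : ∀ {d n} → d ∣ n → n < d → n ≡ 0
∣∧<⇒≡0 {n = zero}  _   _   = refl
∣∧<⇒≡0 {n = suc _} d∣n n<d = contradiction d∣n (>⇒∤ n<d)

%-injective-coprime : ∀ {m n r s} .{{_ : NonZero m}} .{{_ : NonZero n}} → Coprime m n →
                      r < m * n → s < m * n → r % m ≡ s % m → r % n ≡ s % n → r ≡ s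
%-injective-coprime {m} {n} {r} {s} c r< s< ≡m ≡n =
  [ (λ r≤s → ordered r≤s s< ≡m ≡n) , (λ s≤r → sym (ordered s≤r r< (sym ≡m) (sym ≡n))) ]′
    (≤-total r s)
  where
  ordered : ∀ {r s} → r ≤ s → s < m * n → r % m ≡ s % m → r % n ≡ s % n → r ≡ s
  ordered {r} {s} r≤s s< ≡m ≡n =
    ≤-antisym r≤s (m∸n≡0⇒m≤n (∣∧<⇒≡0 m*n∣s∸r (≤-<-trans (m∸n≤m s r) s<)))
    where
    m*n∣s∸r : m * n ∣ s ∸ r
    m*n∣s∸r = coprime⇒*-∣ c (m%n≡o%n⇒n∣o∸m r m s ≡m) (m%n≡o%n⇒n∣o∸m r n s ≡n)

1+d-coprimeTo-d+[1+d]*n : ∀ d n → Coprime (suc d) (d + suc d * n)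
1+d-coprimeTo-d+[1+d]*n d n {g} (g∣1+d , g∣d+[1+d]*n) = ∣1⇒≡1 (∣m+n∣m⇒∣n g∣d+1 g∣d)
  where
  g∣d : g ∣ d
  g∣d = ∣m+n∣m⇒∣n (subst (g ∣_) (+-comm d (suc d * n)) g∣d+[1+d]*n) (∣m⇒∣m*n n g∣1+d)
  g∣d+1 : g ∣ d + 1
  g∣d+1 = subst (g ∣_) (+-comm 1 d) g∣1+d

[1+m]%n≡[1+m%n]%n : ∀ m n .{{_ : NonZero n}} → suc m % n ≡ suc (m % n) % n
[1+m]%n≡[1+m%n]%n m n = begin
  (1 + m) % n               ≡⟨ %-distribˡ-+ 1 m n ⟩
  (1 % n + m % n) % n       ≡⟨ cong (λ k → (1 % n + k) % n) (m%n%n≡m%n m n) ⟨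
  (1 % n + m % n % n) % n   ≡⟨ %-distribˡ-+ 1 (m % n) n ⟨
  (1 + m % n) % n           ∎
  where open ≡-Reasoning

digitwise-+ : ∀ a b c d k → (a + b * k) + (c + d * k) ≡ (a + c) + (b + d) * k
digitwise-+ = solve-∀

[m*n]^o≡m^o*n^o : ∀ m n o → (m * n) ^ o ≡ m ^ o * n ^ o
[m*n]^o≡m^o*n^o m n zero    = refl
[m*n]^o≡m^o*n^o m n (suc o) =
  trans (cong (m * n *_) ([m*n]^o≡m^o*n^o m n o)) (interchange m n (m ^ o) (n ^ o))
  where
  interchange : ∀ a b c d → a * b * (c * d) ≡ a * c * (b * d)
  interchange = solve-∀

[m^n]^o≡[m^o]^n : ∀ m n o → (m ^ n) ^ o ≡ (m ^ o) ^ n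
[m^n]^o≡[m^o]^n m n o = trans (^-*-assoc m n o) (trans (cong (m ^_) (*-comm n o)) (sym (^-*-assoc m o n)))

^-mono-ratio : ∀ {a b c} q p k → a ^ q * b ^ p ≤ c ^ q → (a ^ k) ^ q * (b ^ k) ^ p ≤ (c ^ k) ^ q
^-mono-ratio {a} {b} {c} q p k a^q*b^p≤c^q = begin
  (a ^ k) ^ q * (b ^ k) ^ p  ≡⟨ cong₂ _*_ ([m^n]^o≡[m^o]^n a k q) ([m^n]^o≡[m^o]^n b k p) ⟩
  (a ^ q) ^ k * (b ^ p) ^ k  ≡⟨ [m*n]^o≡m^o*n^o (a ^ q) (b ^ p) k ⟨
  (a ^ q * b ^ p) ^ k        ≤⟨ ^-monoˡ-≤ k a^q*b^p≤c^q ⟩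
  (c ^ q) ^ k                ≡⟨ [m^n]^o≡[m^o]^n c q k ⟩
  (c ^ k) ^ q                ∎
  where open ≤-Reasoning

sumset-exponent : ∀ {s C N W} p q → s ≤ C * N * W → W ^ q * N ^ p ≤ N ^ q →
                  s ^ q * N ^ p ≤ C ^ q * N ^ (2 * q)
sumset-exponent {s} {C} {N} {W} p q s≤CNW W^q*N^p≤N^q = begin
  s ^ q * N ^ p                    ≤⟨ *-monoˡ-≤ (N ^ p) (^-monoˡ-≤ q s≤CNW) ⟩
  (C * N * W) ^ q * N ^ p          ≡⟨ cong (_* N ^ p) [CNW]^q ⟩
  C ^ q * N ^ q * W ^ q * N ^ p    ≡⟨ reassoc (C ^ q) (N ^ q) (W ^ q) (N ^ p) ⟩
  C ^ q * N ^ q * (W ^ q * N ^ p)  ≤⟨ *-monoʳ-≤ (C ^ q * N ^ q) W^q*N^p≤N^q ⟩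
  C ^ q * N ^ q * N ^ q            ≡⟨ *-assoc (C ^ q) (N ^ q) (N ^ q) ⟩
  C ^ q * (N ^ q * N ^ q)          ≡⟨ cong (C ^ q *_) (^-distribˡ-+-* N q q) ⟨
  C ^ q * N ^ (q + q)              ≡⟨ cong (λ e → C ^ q * N ^ (q + e)) (+-identityʳ q) ⟨
  C ^ q * N ^ (2 * q)              ∎
  where
  open ≤-Reasoning
  [CNW]^q : (C * N * W) ^ q ≡ C ^ q * N ^ q * W ^ q
  [CNW]^q = trans ([m*n]^o≡m^o*n^o (C * N) W q) (cong (_* W ^ q) ([m*n]^o≡m^o*n^o C N q))
  reassoc : ∀ a b c d → a * b * c * d ≡ a * b * (c * d)
  reassoc = solve-∀

unique-⊆⇒length≤ : ∀ {A : Set} {xs ys : List A} → Unique xs → (∀ {z} → z ∈ xs → z ∈ ys) →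
                   length xs ≤ length ys
unique-⊆⇒length≤ {xs = []}     _            _     = z≤n
unique-⊆⇒length≤ {xs = x ∷ xs} (x∉xs ∷ xs!) xs⊆ys with ∈-∃++ (xs⊆ys (here refl))
... | us , vs , refl = begin
  suc (length xs)          ≤⟨ s≤s (unique-⊆⇒length≤ xs! xs⊆us++vs) ⟩
  suc (length (us ++ vs))  ≡⟨ length-++-sucʳ us x vs ⟨
  length (us ++ x ∷ vs)    ∎
  where
  open ≤-Reasoning
  xs⊆us++vs : ∀ {z} → z ∈ xs → z ∈ us ++ vs
  xs⊆us++vs z∈xs with ∈-++⁻ us (xs⊆ys (there z∈xs))
  ... | inj₁ z∈us           = ∈-++⁺ˡ z∈us
  ... | inj₂ (here refl)    = contradiction refl (All.lookup x∉xs z∈xs)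
  ... | inj₂ (there z∈vs)   = ∈-++⁺ʳ us z∈vs

length-cartesianProductWith : ∀ {A B C : Set} (f : A → B → C) xs ys →
                              length (cartesianProductWith f xs ys) ≡ length xs * length ys
length-cartesianProductWith f []       ys = refl
length-cartesianProductWith f (x ∷ xs) ys = begin
  length (map (f x) ys ++ cartesianProductWith f xs ys)          ≡⟨ length-++ (map (f x) ys) ⟩
  length (map (f x) ys) + length (cartesianProductWith f xs ys)  ≡⟨ cong₂ _+_ (length-map (f x) ys)
                                                                      (length-cartesianProductWith f xs ys) ⟩
  length ys + length xs * length ys                              ∎
  where open ≡-Reasoning

withDigits : ℕ → List ℕ → ℕ → List ℕ
withDigits K D zero    = D
withDigits K D (suc m) = cartesianProductWith (λ a b → a + b * K) D (withDigits K D m)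

module _ {K : ℕ} {D : List ℕ} where

  length-withDigits : ∀ m → length (withDigits K D m) ≡ length D ^ suc m
  length-withDigits zero    = sym (*-identityʳ (length D))
  length-withDigits (suc m) =
    trans (length-cartesianProductWith _ D (withDigits K D m)) (cong (length D *_) (length-withDigits m))

  withDigits-< : (∀ {a} → a ∈ D → a < K) → ∀ m {n} → n ∈ withDigits K D m → n < K ^ suc m
  withDigits-< D<K zero    n∈ = subst (_ <_) (sym (*-identityʳ K)) (D<K n∈)
  withDigits-< D<K (suc m) n∈ with ∈-cartesianProductWith⁻ _ D (withDigits K D m) n∈
  ... | a , b , a∈D , b∈ , refl = begin-strict
    a + b * K            <⟨ +-monoˡ-< (b * K) (D<K a∈D) ⟩
    K + b * K            ≤⟨ *-monoˡ-≤ K (withDigits-< D<K m b∈) ⟩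
    K ^ suc m * K        ≡⟨ *-comm (K ^ suc m) K ⟩
    K ^ suc (suc m)      ∎
    where open ≤-Reasoning

  withDigits-+ : ∀ {E : List ℕ} → (∀ {a b} → a ∈ D → b ∈ D → a + b ∈ E) →
                 ∀ m {n n′} → n ∈ withDigits K D m → n′ ∈ withDigits K D m → n + n′ ∈ withDigits K E m
  withDigits-+ D+D⊆E zero    n∈ n′∈ = D+D⊆E n∈ n′∈
  withDigits-+ {E} D+D⊆E (suc m) n∈ n′∈
    with ∈-cartesianProductWith⁻ _ D (withDigits K D m) n∈
       | ∈-cartesianProductWith⁻ _ D (withDigits K D m) n′∈
  ... | a , b , a∈D , b∈ , refl | a′ , b′ , a′∈D , b′∈ , refl =
    subst (_∈ withDigits K E (suc m)) (sym (digitwise-+ a b a′ b′ K))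
      (∈-cartesianProductWith⁺ (λ a b → a + b * K) (D+D⊆E a∈D a′∈D) (withDigits-+ D+D⊆E m b∈ b′∈))

-- Walks and their steps

-- w (i+1) - w i = w (j+1) - w j, stated additively as w is ℕ-valued.
SameStep : (ℕ → ℕ) → ℕ → ℕ → Set
SameStep w i j = w (suc i) + w j ≡ w (suc j) + w i

Closed : (ℕ → ℕ) → ℕ → Set
Closed w L = w L ≡ w 0

DistinctSteps : (ℕ → ℕ) → ℕ → Set
DistinctSteps w L = ∀ {i} → i < L → ∀ {j} → j < L → SameStep w i j → i ≡ j

NonzeroSteps : (ℕ → ℕ) → ℕ → Set
NonzeroSteps w L = ∀ {i} → i < L → w (suc i) ≢ w i

record IsCycle (w : ℕ → ℕ) (L : ℕ) : Set where
  field
    closed   : Closed w L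
    distinct : DistinctSteps w L
    nonzero  : NonzeroSteps w L

periodic : (ℕ → ℕ) → (L : ℕ) .{{_ : NonZero L}} → ℕ → ℕ
periodic w L r = w (r % L)

module _ (w : ℕ → ℕ) (L : ℕ) .{{_ : NonZero L}} where

  periodic-+ : ∀ r → periodic w L (L + r) ≡ periodic w L r
  periodic-+ r = cong w (trans (cong (_% L) (+-comm L r)) ([m+n]%n≡m%n r L))

  periodic-* : ∀ k → periodic w L (k * L) ≡ w 0
  periodic-* k = cong w (m*n%n≡0 k L)

  module _ (closed : Closed w L) where

    periodic-suc : ∀ r → periodic w L (suc r) ≡ w (suc (r % L))
    periodic-suc r with m≤n⇒m<n∨m≡n (m%n<n r L)
    ... | inj₁ 1+r%L<L = cong w (trans ([1+m]%n≡[1+m%n]%n r L) (m<n⇒m%n≡m 1+r%L<L))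
    ... | inj₂ 1+r%L≡L = begin
      w (suc r % L)             ≡⟨ cong w ([1+m]%n≡[1+m%n]%n r L) ⟩
      w (suc (r % L) % L)       ≡⟨ cong (λ k → w (k % L)) 1+r%L≡L ⟩
      w (L % L)                 ≡⟨ cong w (n%n≡0 L) ⟩
      w 0                       ≡⟨ closed ⟨
      w L                       ≡⟨ cong w 1+r%L≡L ⟨
      w (suc (r % L))           ∎
      where open ≡-Reasoning

    periodic-sameStep : ∀ {r s} → SameStep (periodic w L) r s → SameStep w (r % L) (s % L)
    periodic-sameStep {r} {s} eq =
      trans (cong (_+ w (s % L)) (sym (periodic-suc r))) (trans eq (cong (_+ w (r % L)) (periodic-suc s)))

    periodic-distinct : DistinctSteps w L → ∀ {r s} → SameStep (periodic w L) r s → r % L ≡ s % L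
    periodic-distinct distinct {r} {s} eq = distinct (m%n<n r L) (m%n<n s L) (periodic-sameStep eq)

    periodic-nonzero : NonzeroSteps w L → ∀ r → periodic w L (suc r) ≢ periodic w L r
    periodic-nonzero nonzero r eq = nonzero (m%n<n r L) (trans (sym (periodic-suc r)) eq)

twoDigit : ℕ → (ℕ → ℕ) → (ℕ → ℕ) → ℕ → ℕ
twoDigit K u v t = u t + v t * K

module _ {K : ℕ} (u v : ℕ → ℕ) (u-small : ∀ s t → u s + u t < K) where

  twoDigit-sameStep : ∀ {i j} → SameStep (twoDigit K u v) i j → SameStep u i j × SameStep v i j
  twoDigit-sameStep {i} {j} eq = digits-injective (u-small (suc i) j) (u-small (suc j) i) (begin
    (u (suc i) + u j) + (v (suc i) + v j) * K ≡⟨ digitwise-+ (u (suc i)) (v (suc i)) (u j) (v j) K ⟨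
    twoDigit K u v (suc i) + twoDigit K u v j ≡⟨ eq ⟩
    twoDigit K u v (suc j) + twoDigit K u v i ≡⟨ digitwise-+ (u (suc j)) (v (suc j)) (u i) (v i) K ⟩
    (u (suc j) + u i) + (v (suc j) + v i) * K ∎)
    where open ≡-Reasoning

  twoDigit-stalls : ∀ {i} → twoDigit K u v (suc i) ≡ twoDigit K u v i → u (suc i) ≡ u i × v (suc i) ≡ v i
  twoDigit-stalls {i} = digits-injective (u<K (suc i)) (u<K i)
    where
    u<K : ∀ t → u t < K
    u<K t = m+n≤o⇒m≤o (suc (u t)) (u-small t t)

flat-steps-same : ∀ {w : ℕ → ℕ} {i j} → w (suc i) ≡ w i → w (suc j) ≡ w j → SameStep w i j
flat-steps-same {w} {i} {j} flat-i flat-j = begin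
  w (suc i) + w j ≡⟨ cong₂ _+_ flat-i (sym flat-j) ⟩
  w i + w (suc j) ≡⟨ +-comm (w i) (w (suc j)) ⟩
  w (suc j) + w i ∎
  where open ≡-Reasoning

sameStep-flat : ∀ {w : ℕ → ℕ} {i j} → w (suc i) ≡ w i → SameStep w i j → w (suc j) ≡ w j
sameStep-flat {w} {i} {j} flat-i eq = sym (+-cancelˡ-≡ (w i) _ _ (begin
  w i + w j       ≡⟨ cong (_+ w j) flat-i ⟨
  w (suc i) + w j ≡⟨ eq ⟩
  w (suc j) + w i ≡⟨ +-comm (w (suc j)) (w i) ⟩
  w i + w (suc j) ∎))
  where open ≡-Reasoning

module _ {w z : ℕ → ℕ} (d : ℕ) (shift : ∀ r → w (d + r) ≡ z r) where

  private
    shift-suc : ∀ r → w (suc (d + r)) ≡ z (suc r)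
    shift-suc r = trans (cong w (sym (+-suc d r))) (shift (suc r))

  sameStep-shift : ∀ {r s} → SameStep w (d + r) (d + s) → SameStep z r s
  sameStep-shift {r} {s} eq = begin
    z (suc r) + z s               ≡⟨ cong₂ _+_ (shift-suc r) (shift s) ⟨
    w (suc (d + r)) + w (d + s)   ≡⟨ eq ⟩
    w (suc (d + s)) + w (d + r)   ≡⟨ cong₂ _+_ (shift-suc s) (shift r) ⟩
    z (suc s) + z r               ∎
    where open ≡-Reasoning

  flat-shift : ∀ {r} → w (suc (d + r)) ≡ w (d + r) → z (suc r) ≡ z r
  flat-shift {r} eq = trans (sym (shift-suc r)) (trans eq (shift r))

data Offset (d : ℕ) : ℕ → Set where
  before : ∀ {t} → t < d → Offset d t
  after  : ∀ r → Offset d (d + r)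

offset : ∀ d t → Offset d t
offset zero    t       = after t
offset (suc d) zero    = before z<s
offset (suc d) (suc t) with offset d t
... | before t<d = before (s<s t<d)
... | after r    = after r

module Lift {d K : ℕ} {x : ℕ → ℕ}
            (x-small    : ∀ s t → x s + x t < K)
            (x-closed   : Closed x (suc d))
            (x-distinct : DistinctSteps x (suc d))
            (x-stalls   : x 1 ≡ x 0)
            where

  private
    p : ℕ
    p = suc d

    periodic-x-small : ∀ s t → periodic x p s + periodic x p t < K
    periodic-x-small s t = x-small (s % p) (t % p)

  -- Dropping the stall x 0 → x 1 leaves a cycle with nonzero steps.
  tour : ℕ → ℕ
  tour t = periodic x p (suc t)

  private
    tour-small : ∀ s t → tour s + tour t < K
    tour-small s t = periodic-x-small (suc s) (suc t)

    tour-0 : tour 0 ≡ x 0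
    tour-0 = trans (periodic-suc x p x-closed 0) x-stalls

  tour-isCycle : IsCycle tour d
  tour-isCycle = record { closed = closed ; distinct = distinct ; nonzero = nonzero }
    where
    closed : tour d ≡ tour 0
    closed = trans (cong x (n%n≡0 p)) (sym tour-0)

    index : ∀ {i} → i < d → suc i % p ≡ suc i
    index i<d = m<n⇒m%n≡m (s<s i<d)

    distinct : DistinctSteps tour d
    distinct i<d j<d eq =
      suc-injective (trans (sym (index i<d))
        (trans (periodic-distinct x p x-closed x-distinct eq) (index j<d)))

    nonzero : NonzeroSteps tour d
    nonzero {i} i<d flat = 0≢1+n (sym (trans (sym (index i<d))
      (periodic-distinct x p x-closed x-distinct {suc i} {0} (flat-steps-same {periodic x p} flat tour-0))))

  -- For its first d steps only the low digit moves, along the tour; from then on it is the product walk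
  -- r ↦ (x (r mod 1+d), y (r mod L)) in base K, whose steps are distinct by the Chinese remainder theorem.
  lift : (L : ℕ) .{{_ : NonZero L}} → (ℕ → ℕ) → ℕ → ℕ
  lift L y = twoDigit K tour (λ t → periodic y L (t ∸ d))

  module _ {L : ℕ} .{{_ : NonZero L}} {y : ℕ → ℕ} (coprime : Coprime p L) (y-cycle : IsCycle y L) where
    open IsCycle y-cycle renaming (closed to y-closed; distinct to y-distinct; nonzero to y-nonzero)

    private
      high : ℕ → ℕ
      high t = periodic y L (t ∸ d)

      high-shift : ∀ r → high (d + r) ≡ periodic y L r
      high-shift r = cong (periodic y L) (m+n∸m≡n d r)

      high-flat : ∀ {i} → i < d → high (suc i) ≡ high i
      high-flat i<d = cong (periodic y L) (trans (m≤n⇒m∸n≡0 i<d) (sym (m≤n⇒m∸n≡0 (<⇒≤ i<d))))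

      product : ℕ → ℕ
      product = twoDigit K (periodic x p) (periodic y L)

      lift-shift : ∀ r → lift L y (d + r) ≡ product r
      lift-shift r = cong₂ (λ a b → a + b * K) (periodic-+ x p r) (high-shift r)

      product-distinct : DistinctSteps product (p * L)
      product-distinct r< s< eq with twoDigit-sameStep (periodic x p) (periodic y L) periodic-x-small eq
      ... | same-x , same-y = %-injective-coprime coprime r< s<
        (periodic-distinct x p x-closed x-distinct same-x) (periodic-distinct y L y-closed y-distinct same-y)

      product-nonzero : ∀ r → product (suc r) ≢ product r
      product-nonzero r flat = periodic-nonzero y L y-closed y-nonzero r
        (proj₂ (twoDigit-stalls (periodic x p) (periodic y L) periodic-x-small flat))

      prefix-step≢later-step : ∀ {i r} → i < d → ¬ SameStep (lift L y) i (d + r)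
      prefix-step≢later-step {r = r} i<d eq = periodic-nonzero y L y-closed y-nonzero r
        (flat-shift {high} d high-shift
          (sameStep-flat {high} (high-flat i<d) (proj₂ (twoDigit-sameStep tour high tour-small eq))))

    lift-isCycle : IsCycle (lift L y) (d + p * L)
    lift-isCycle = record { closed = closed ; distinct = distinct ; nonzero = nonzero }
      where
      closed : lift L y (d + p * L) ≡ lift L y 0
      closed = begin
        lift L y (d + p * L)                             ≡⟨ lift-shift (p * L) ⟩
        periodic x p (p * L) + periodic y L (p * L) * K  ≡⟨ cong₂ (λ a b → a + b * K) x-wraps (periodic-* y L p) ⟩
        x 0 + y 0 * K                                    ≡⟨ cong₂ (λ a b → a + b * K) tour-0 y-starts ⟨
        lift L y 0                                       ∎
        where
        open ≡-Reasoning
        x-wraps : periodic x p (p * L) ≡ x 0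
        x-wraps = trans (cong (periodic x p) (*-comm p L)) (periodic-* x p L)
        y-starts : periodic y L (0 ∸ d) ≡ y 0
        y-starts = trans (cong (periodic y L) (0∸n≡0 d)) (periodic-* y L 0)

      distinct : DistinctSteps (lift L y) (d + p * L)
      distinct {i} i< {j} j< eq with offset d i | offset d j
      ... | before i<d | before j<d =
        IsCycle.distinct tour-isCycle i<d j<d (proj₁ (twoDigit-sameStep tour high tour-small eq))
      ... | before i<d | after _    = contradiction eq (prefix-step≢later-step i<d)
      ... | after _    | before j<d = contradiction (sym eq) (prefix-step≢later-step j<d)
      ... | after r    | after s    = cong (d +_)
        (product-distinct (+-cancelˡ-< d r (p * L) i<) (+-cancelˡ-< d s (p * L) j<)
          (sameStep-shift {lift L y} d lift-shift eq))

      nonzero : NonzeroSteps (lift L y) (d + p * L)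
      nonzero {i} _ flat with offset d i
      ... | before i<d = IsCycle.nonzero tour-isCycle i<d (proj₁ (twoDigit-stalls tour high tour-small flat))
      ... | after r    = product-nonzero r (flat-shift {lift L y} d lift-shift flat)

-- From a walk to a set with distinct consecutive differences

consecDiffs-applyUpTo : ∀ (f : ℕ → ℤ) n →
                        consecDiffs (applyUpTo f (suc n)) ≡ applyUpTo (λ t → f (suc t) ℤ.- f t) n
consecDiffs-applyUpTo f zero    = refl
consecDiffs-applyUpTo f (suc n) = cong (f 1 ℤ.- f 0 ∷_) (consecDiffs-applyUpTo (λ t → f (suc t)) n)

-≡-⇒+≡+ : ∀ a b a′ b′ → a ℤ.- b ≡ a′ ℤ.- b′ → a ℤ.+ b′ ≡ a′ ℤ.+ b
-≡-⇒+≡+ a b a′ b′ eq = begin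
  a ℤ.+ b′                    ≡⟨ split a b b′ ⟩
  (a ℤ.- b) ℤ.+ (b ℤ.+ b′)    ≡⟨ cong (ℤ._+ (b ℤ.+ b′)) eq ⟩
  (a′ ℤ.- b′) ℤ.+ (b ℤ.+ b′)  ≡⟨ cong (λ u → (a′ ℤ.- b′) ℤ.+ u) (ℤ.+-comm b b′) ⟩
  (a′ ℤ.- b′) ℤ.+ (b′ ℤ.+ b)  ≡⟨ split a′ b′ b ⟨
  a′ ℤ.+ b                    ∎
  where
  open ≡-Reasoning
  split : ∀ x y z → x ℤ.+ z ≡ (x ℤ.- y) ℤ.+ (y ℤ.+ z)
  split = ℤ-Solver.solve-∀

graph : ℕ → (ℕ → ℕ) → ℕ → List ℤ
graph c w L = applyUpTo (λ t → ℤ.+ twoDigit c w id t) (suc L)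

length-graph : ∀ c w L → length (graph c w L) ≡ suc L
length-graph c w L = length-applyUpTo (λ t → ℤ.+ twoDigit c w id t) (suc L)

module _ {c : ℕ} (w : ℕ → ℕ) (small : ∀ s t → w s + w t < c) where

  graph-increasing : ∀ L → StrictlyIncreasing (graph c w L)
  graph-increasing L = Linked.applyUpTo⁺₁ _ (suc L) (λ {i} _ → ℤ.+<+ (increasing i))
    where
    open ≤-Reasoning
    increasing : ∀ i → w i + i * c < w (suc i) + suc i * c
    increasing i = begin-strict
      w i + i * c              <⟨ +-monoˡ-< (i * c) (m+n≤o⇒m≤o (suc (w i)) (small i i)) ⟩
      suc i * c                ≤⟨ m≤n+m (suc i * c) (w (suc i)) ⟩
      w (suc i) + suc i * c    ∎

  graph-distinctDiffs : ∀ {L} → DistinctSteps w L → DistinctConsecDiffs (graph c w L)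
  graph-distinctDiffs {L} distinct =
    subst Unique (sym (consecDiffs-applyUpTo f L))
      (Unique.applyUpTo⁺₁ _ L (λ i<j j<L eq → <⇒≢ i<j (distinct (<-trans i<j j<L) j<L (sameStep eq))))
    where
    f : ℕ → ℤ
    f t = ℤ.+ twoDigit c w id t
    sameStep : ∀ {i j} → f (suc i) ℤ.- f i ≡ f (suc j) ℤ.- f j → SameStep w i j
    sameStep {i} {j} eq =
      proj₁ (twoDigit-sameStep w id small (ℤ.+-injective (-≡-⇒+≡+ (f (suc i)) (f i) (f (suc j)) (f j) eq)))

graph-sumset : ∀ c w L {S : List ℕ} → (∀ s t → w s + w t ∈ S) →
               sumsetSize (graph c w L) ≤ length S * suc (2 * L)
graph-sumset c w L {S} sums∈S = begin
  sumsetSize (graph c w L)  ≤⟨ unique-⊆⇒length≤ (deduplicate-! ℤ._≟_ (allSums A))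
                                 (λ z∈ → sum∈T (∈-deduplicate⁻ ℤ._≟_ (allSums A) z∈)) ⟩
  length T                  ≡⟨ trans (length-map ℤ.+_ (cartesianProductWith _ S (upTo (suc (2 * L)))))
                                 (trans (length-cartesianProductWith _ S (upTo (suc (2 * L))))
                                        (cong (length S *_) (length-upTo (suc (2 * L))))) ⟩
  length S * suc (2 * L)    ∎
  where
  open ≤-Reasoning
  f : ℕ → ℤ
  f t = ℤ.+ twoDigit c w id t
  A : List ℤ
  A = graph c w L
  T : List ℤ
  T = map ℤ.+_ (cartesianProductWith (λ σ s → σ + s * c) S (upTo (suc (2 * L))))
  sum∈T : ∀ {z} → z ∈ allSums A → z ∈ T
  sum∈T z∈ with find (∈-concatMap⁻ (λ a → map (λ a′ → a ℤ.+ a′) A) {xs = A} z∈)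
  ... | a , a∈A , z∈a+A with ∈-map⁻ (λ a′ → a ℤ.+ a′) z∈a+A | ∈-applyUpTo⁻ f a∈A
  ... | a′ , a′∈A , refl | t , t≤L , refl with ∈-applyUpTo⁻ f a′∈A
  ... | t′ , t′≤L , refl = subst (_∈ T) (cong ℤ.+_ (sym (digitwise-+ (w t) t (w t′) t′ c)))
        (∈-map⁺ ℤ.+_ (∈-cartesianProductWith⁺ (λ σ s → σ + s * c) (sums∈S t t′) (∈-upTo⁺ t+t′<1+2L)))
    where
    t+t′<1+2L : t + t′ < suc (2 * L)
    t+t′<1+2L = s≤s (+-mono-≤ (≤-pred t≤L) (subst (t′ ≤_) (sym (+-identityʳ L)) (≤-pred t′≤L)))

B : List ℕ
B = 0 ∷ 1 ∷ 4 ∷ 10 ∷ 12 ∷ 17 ∷ []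

B+B : List ℕ
B+B = 0 ∷ 1 ∷ 2 ∷ 4 ∷ 5 ∷ 8 ∷ 10 ∷ 11 ∷ 12 ∷ 13 ∷ 14 ∷
      16 ∷ 17 ∷ 18 ∷ 20 ∷ 21 ∷ 22 ∷ 24 ∷ 27 ∷ 29 ∷ 34 ∷ []

-- An Eulerian circuit of the complete digraph on B, starting with the loop 0 → 0, so that its
-- steps are 0 and every nonzero element of B - B exactly once.
eulerCircuit : Vec ℕ 31
eulerCircuit = 0 ∷ 0 ∷ 1 ∷ 0 ∷ 4 ∷ 0 ∷ 10 ∷ 0 ∷ 12 ∷ 0 ∷ 17 ∷
          1 ∷ 4 ∷ 1 ∷ 10 ∷ 1 ∷ 12 ∷ 1 ∷ 17 ∷
          4 ∷ 10 ∷ 4 ∷ 12 ∷ 4 ∷ 17 ∷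
          10 ∷ 12 ∷ 10 ∷ 17 ∷ 12 ∷ 17 ∷ []

circuit : ℕ → ℕ
circuit t = lookup eulerCircuit (t mod 31)

circuit-distinct : DistinctSteps circuit 31
circuit-distinct = from-yes (allUpTo? (λ i → allUpTo? (λ j →
  (circuit (suc i) + circuit j ≟ circuit (suc j) + circuit i) →-dec (i ≟ j)) 31) 31)

circuit∈B : ∀ t → circuit t ∈ B
circuit∈B t = VecAll.lookup (from-yes (VecAll.all? (_∈? B) eulerCircuit)) (∈-lookup (t mod 31) eulerCircuit)

B≤17 : ∀ {a} → a ∈ B → a ≤ 17
B≤17 = All.lookup (from-yes (All.all? (_≤? 17) B))

B+B<35 : ∀ {a} → a ∈ B+B → a < 35
B+B<35 = All.lookup (from-yes (All.all? (_<? 35) B+B))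

B+B⊇sums : ∀ {a b} → a ∈ B → b ∈ B → a + b ∈ B+B
B+B⊇sums a∈B b∈B =
  All.lookup (All.lookup (from-yes (All.all? (λ a → All.all? (λ b → a + b ∈? B+B) B) B)) a∈B) b∈B

circuit-small : ∀ s t → circuit s + circuit t < 35
circuit-small s t = s≤s (+-mono-≤ (B≤17 (circuit∈B s)) (B≤17 (circuit∈B t)))

open Lift {x = circuit} circuit-small refl circuit-distinct refl

ℓ : ℕ → ℕ
ℓ zero    = 30
ℓ (suc m) = 30 + 31 * ℓ m

ℓ-nonZero : ∀ m → NonZero (ℓ m)
ℓ-nonZero zero    = _
ℓ-nonZero (suc m) = _

walk : ℕ → ℕ → ℕ
walk zero    = tour
walk (suc m) = lift (ℓ m) {{ℓ-nonZero m}} (walk m)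

walk-isCycle : ∀ m → IsCycle (walk m) (ℓ m)
walk-isCycle zero    = tour-isCycle
walk-isCycle (suc m) = lift-isCycle {{ℓ-nonZero m}} (coprime m) (walk-isCycle m)
  where
  coprime : ∀ m → Coprime 31 (ℓ m)
  coprime zero    = 1+d-coprimeTo-d+[1+d]*n 30 0
  coprime (suc m) = 1+d-coprimeTo-d+[1+d]*n 30 (ℓ m)

walk-∈ : ∀ m t → walk m t ∈ withDigits 35 B m
walk-∈ zero    t = circuit∈B (suc t % 31)
walk-∈ (suc m) t = ∈-cartesianProductWith⁺ (λ a b → a + b * 35) (circuit∈B (suc t % 31)) (walk-∈ m _)

walk-sums : ∀ m s t → walk m s + walk m t ∈ withDigits 35 B+B m
walk-sums m s t = withDigits-+ B+B⊇sums m (walk-∈ m s) (walk-∈ m t)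

walk-sums< : ∀ m s t → walk m s + walk m t < 35 ^ suc m
walk-sums< m s t = withDigits-< B+B<35 m (walk-sums m s t)

1+ℓ≡31^ : ∀ m → suc (ℓ m) ≡ 31 ^ suc m
1+ℓ≡31^ zero    = refl
1+ℓ≡31^ (suc m) = trans (sym (*-suc 31 (ℓ m))) (cong (31 *_) (1+ℓ≡31^ m))

m≤ℓ : ∀ m → m ≤ ℓ m
m≤ℓ zero    = z≤n
m≤ℓ (suc m) = s≤s (≤-trans (m≤ℓ m) (≤-trans (m≤n*m (ℓ m) 31) (m≤n+m (31 * ℓ m) 29)))

A : ℕ → List ℤ
A n = graph (35 ^ suc n) (walk n) (ℓ n)

length-A′ : ∀ n → length (A n) ≡ suc (ℓ n)
length-A′ n = length-graph (35 ^ suc n) (walk n) (ℓ n)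

length-A : ∀ n → length (A n) ≡ 31 ^ suc n
length-A n = trans (length-A′ n) (1+ℓ≡31^ n)

sumsetSize-A : ∀ n → sumsetSize (A n) ≤ 2 * length (A n) * 21 ^ suc n
sumsetSize-A n = begin
  sumsetSize (A n)                              ≤⟨ graph-sumset (35 ^ suc n) (walk n) (ℓ n) (walk-sums n) ⟩
  length (withDigits 35 B+B n) * suc (2 * ℓ n)  ≡⟨ cong (_* suc (2 * ℓ n)) (length-withDigits n) ⟩
  21 ^ suc n * suc (2 * ℓ n)                    ≤⟨ *-monoʳ-≤ (21 ^ suc n) 1+2ℓ≤2[1+ℓ] ⟩
  21 ^ suc n * (2 * suc (ℓ n))                  ≡⟨ *-comm (21 ^ suc n) (2 * suc (ℓ n)) ⟩
  2 * suc (ℓ n) * 21 ^ suc n                    ≡⟨ cong (λ N → 2 * N * 21 ^ suc n) (length-A′ n) ⟨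
  2 * length (A n) * 21 ^ suc n                 ∎
  where
  open ≤-Reasoning
  1+2ℓ≤2[1+ℓ] : suc (2 * ℓ n) ≤ 2 * suc (ℓ n)
  1+2ℓ≤2[1+ℓ] = ≤-trans (n≤1+n _) (≤-reflexive (sym (*-suc 2 (ℓ n))))

n≤length-A : ∀ n → n ≤ length (A n)
n≤length-A n = subst (n ≤_) (sym (length-A′ n)) (m≤n⇒m≤1+n (m≤ℓ n))

length-A-ratio : ∀ n → (21 ^ suc n) ^ 9 * length (A n) ^ 1 ≤ length (A n) ^ 9
length-A-ratio n = subst (λ N → (21 ^ suc n) ^ 9 * N ^ 1 ≤ N ^ 9) (sym (length-A n))
  (^-mono-ratio {21} {31} {31} 9 1 (suc n) (from-yes (21 ^ 9 * 31 ^ 1 ≤? 31 ^ 9)))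

mainTheorem7 : Σ ℕ λ p → Σ ℕ λ q → (0 < q) × (q < 10 * p) ×
    Σ ℕ λ C → (n : ℕ) → Σ (List ℤ) λ A →
      StrictlyIncreasing A × DistinctConsecDiffs A × (n ≤ length A) ×
      (sumsetSize A ^ q * length A ^ p ≤ C ^ q * length A ^ (2 * q))
mainTheorem7 = 1 , 9 , z<s , ≤-refl , 2 , λ n →
  A n ,
  graph-increasing (walk n) (walk-sums< n) (ℓ n) ,
  graph-distinctDiffs (walk n) (walk-sums< n) (IsCycle.distinct (walk-isCycle n)) ,
  n≤length-A n ,
  sumset-exponent {sumsetSize (A n)} {2} {length (A n)} {21 ^ suc n} 1 9
    (sumsetSize-A n) (length-A-ratio n)
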